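{- Let $p$ be a prime, $d\ge 2$, and let $\mathbf{a}=\langle a_1,\ldots,a_d\rangle\in\mathbf{P}^{d-1}(\mathbf{F}_p)$. Then \[ h_p(\mathbf{a})\le \left[\frac{d^{\ast}(\mathbf{a})\,p}{2}\right]. \]
   Context: $\mathbf{F}_p=\mathbf{Z}/p\mathbf{Z}$. $\mathbf{P}^{d-1}(\mathbf{F}_p)$ is the set of equivalence classes $\langle a_1,\ldots,a_d\rangle$ of nonzero $d$-tuples in $\mathbf{F}_p^d$ under $(a_1,\ldots,a_d)\sim(ka_1,\ldots,ka_d)$ for $k\in\mathbf{F}_p^{\ast}$. For $x\in\mathbf{F}_p$, $x \bmod p$ denotes the least nonnegative integer in the class $x$. The height is $h_p(\mathbf{a})=\min\{\sum_{i=1}^d (ka_i \bmod p): k=1,\ldots,p-1\}$ (independent of the representative). $d^{\ast}(\mathbf{a})$ is the number of nonzero coordinates $a_i$ of $\mathbf{a}$. $[t]$ denotes the greatest integer not exceeding the real number $t$. -}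

module Defs where

open import Data.Nat using (ℕ; zero; suc; _+_; _*_; _⊓_; _<_; _≡ᵇ_)
open import Data.Nat.DivMod using (_%_; _/_)
open import Data.Nat.Primality using (Prime)
open import Data.Vec using (Vec; map; sum; count)
open import Data.Vec.Relation.Unary.Any using (Any)
open import Data.Vec.Relation.Unary.All using (All)
open import Relation.Binary.PropositionalEquality using (_≡_)
open import Relation.Nullary using (¬_)
open import Data.Nat using (_≟_)
open import Data.Bool using (Bool; not)
open import Relation.Nullary.Decidable using (¬?)

-- A representative of a point of P^{d-1}(F_p): a d-tuple of residues in
-- {0,…,p-1} (elements of F_p = Z/pZ as their least nonnegative
-- representatives), not all zero.
IsProjRep : (p d : ℕ) → Vec ℕ d → Set
IsProjRep p d a = All (_< p) a × Any (λ x → ¬ (x ≡ 0)) a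
  where open import Data.Product using (_×_)

weight : (p : ℕ) .{{_ : Data.Nat.NonZero p}} {d : ℕ} → ℕ → Vec ℕ d → ℕ
weight p k a = sum (map (λ x → (k * x) % p) a)

minWeight : (p : ℕ) .{{_ : Data.Nat.NonZero p}} {d : ℕ} → ℕ → Vec ℕ d → ℕ
minWeight p zero a = weight p 1 a   -- unused base (m ≥ 1 in use)
minWeight p (suc zero) a = weight p 1 a
minWeight p (suc (suc m)) a = minWeight p (suc m) a ⊓ weight p (suc (suc m)) a

height : (p : ℕ) .{{_ : Data.Nat.NonZero p}} {d : ℕ} → Vec ℕ d → ℕ
height p a = minWeight p (Data.Nat.pred p) a

dstar : {d : ℕ} → Vec ℕ d → ℕ
dstar a = count (λ x → ¬? (x ≟ 0)) a

-- Taking k = 1 and k = p − 1 sends each nonzero coordinate x to x and to p − x,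
-- so these two weights add up to d*(a)·p, and the height, being at most both,
-- is at most half of that.
module Submission where

open import Defs
open import Algebra.Properties.CommutativeSemigroup using (interchange)
open import Data.Nat
  using (ℕ; zero; suc; _+_; _*_; _∸_; _/_; _%_; _≤_; _<_; _≤′_; ≤′-refl; ≤′-step; s≤s; z≤n;
         NonZero; pred; nonTrivial⇒n>1)
open import Data.Nat.DivMod using (m*n/n≡m; /-monoˡ-≤; m<n⇒m%n≡m; [m+kn]%n≡m%n)
open import Data.Nat.Primality using (Prime; prime⇒nonTrivial)
open import Data.Nat.Properties
open import Data.Nat.Tactic.RingSolver using (solve-∀)
open import Data.Product using (_,_)
open import Data.Vec using (Vec; []; _∷_)
open import Data.Vec.Relation.Unary.All using (All; []; _∷_)
open import Relation.Binary.PropositionalEquality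
  using (_≡_; refl; trans; cong; cong₂; subst; module ≡-Reasoning)

m*n≤o⇒m≤o/n : ∀ m n o .{{_ : NonZero n}} → m * n ≤ o → m ≤ o / n
m*n≤o⇒m≤o/n m n o m*n≤o = subst (_≤ o / n) (m*n/n≡m m n) (/-monoˡ-≤ n m*n≤o)

[pred[n]*m]%n≡n∸m : ∀ {m n} .{{_ : NonZero n}} → 0 < m → m < n → (pred n * m) % n ≡ n ∸ m
[pred[n]*m]%n≡n∸m {suc y} {suc (suc k)} _ (s≤s (s≤s y≤k))
  with t , refl ← m≤n⇒∃[o]m+o≡n y≤k = begin
    (suc (y + t) * suc y) % n             ≡⟨ cong (_% n) (pred[n]*m≡n∸m+[m∸1]*n y t) ⟩
    (suc t + y * n) % n                   ≡⟨ [m+kn]%n≡m%n (suc t) y n ⟩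
    suc t % n                             ≡⟨ m<n⇒m%n≡m (s≤s (s≤s (m≤n+m t y))) ⟩
    suc t                                 ≡⟨ m+n∸m≡n (suc y) (suc t) ⟨
    suc y + suc t ∸ suc y                 ≡⟨ cong (_∸ suc y) (+-suc (suc y) t) ⟩
    n ∸ suc y                             ∎
  where
    open ≡-Reasoning
    n : ℕ
    n = suc (suc (y + t))
    pred[n]*m≡n∸m+[m∸1]*n : ∀ y t → suc (y + t) * suc y ≡ suc t + y * suc (suc (y + t))
    pred[n]*m≡n∸m+[m∸1]*n = solve-∀

weight-1+weight-pred≡dstar*p : ∀ p .{{_ : NonZero p}} {d} (a : Vec ℕ d) → All (_< p) a →
                              weight p 1 a + weight p (pred p) a ≡ dstar a * p
weight-1+weight-pred≡dstar*p p [] [] = refl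
weight-1+weight-pred≡dstar*p p@(suc n) (zero ∷ a) (_ ∷ a<p) = begin
  weight p 1 a + ((n * 0) % p + weight p n a) ≡⟨ cong (λ u → weight p 1 a + (u % p + weight p n a)) (*-zeroʳ n) ⟩
  weight p 1 a + weight p n a                 ≡⟨ weight-1+weight-pred≡dstar*p p a a<p ⟩
  dstar a * p                                 ∎
  where open ≡-Reasoning
weight-1+weight-pred≡dstar*p p@(suc n) (x@(suc _) ∷ a) (x<p ∷ a<p) = begin
  (1 * x) % p + weight p 1 a + ((n * x) % p + weight p n a)
    ≡⟨ cong₂ (λ u v → u + weight p 1 a + (v + weight p n a))
         (trans (cong (_% p) (*-identityˡ x)) (m<n⇒m%n≡m x<p)) ([pred[n]*m]%n≡n∸m (s≤s z≤n) x<p) ⟩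
  x + weight p 1 a + ((p ∸ x) + weight p n a)
    ≡⟨ interchange +-commutativeSemigroup x (weight p 1 a) (p ∸ x) (weight p n a) ⟩
  (x + (p ∸ x)) + (weight p 1 a + weight p n a)
    ≡⟨ cong₂ _+_ (m+[n∸m]≡n (<⇒≤ x<p)) (weight-1+weight-pred≡dstar*p p a a<p) ⟩
  p + dstar a * p ∎
  where open ≡-Reasoning

minWeight-suc≤minWeight : ∀ p .{{_ : NonZero p}} {d} m (a : Vec ℕ d) →
                          minWeight p (suc m) a ≤ minWeight p m a
minWeight-suc≤minWeight p zero    a = ≤-refl
minWeight-suc≤minWeight p (suc m) a = m⊓n≤m _ _

minWeight-antimono : ∀ p .{{_ : NonZero p}} {d k m} (a : Vec ℕ d) → k ≤′ m →
                     minWeight p m a ≤ minWeight p k a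
minWeight-antimono p a ≤′-refl = ≤-refl
minWeight-antimono p {m = suc m} a (≤′-step k≤′m) =
  ≤-trans (minWeight-suc≤minWeight p m a) (minWeight-antimono p a k≤′m)

minWeight≤weight : ∀ p .{{_ : NonZero p}} {d} m (a : Vec ℕ d) → 1 ≤ m →
                   minWeight p m a ≤ weight p m a
minWeight≤weight p (suc zero)    a _ = ≤-refl
minWeight≤weight p (suc (suc m)) a _ = m⊓n≤n _ _

height≤weight : ∀ p .{{_ : NonZero p}} {d k} (a : Vec ℕ d) → 1 ≤ k → k ≤ pred p →
                height p a ≤ weight p k a
height≤weight p {k = k} a 1≤k k≤pred[p] =
  ≤-trans (minWeight-antimono p a (≤⇒≤′ k≤pred[p])) (minWeight≤weight p k a 1≤k)

lemma1 : (p : ℕ) → .{{_ : Data.Nat.NonZero p}} → Prime p → (d : ℕ) → 2 ≤ d →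
         (a : Vec ℕ d) → IsProjRep p d a →
         height p a ≤ (dstar a * p) / 2
lemma1 p p-prime d _ a (a<p , _) = m*n≤o⇒m≤o/n h 2 (dstar a * p) (begin
  h * 2                                    ≡⟨ *-comm h 2 ⟩
  h + (h + 0)                              ≡⟨ cong (h +_) (+-identityʳ h) ⟩
  h + h                                    ≤⟨ +-mono-≤ (height≤weight p a ≤-refl 1≤pred[p])
                                                       (height≤weight p a 1≤pred[p] ≤-refl) ⟩
  weight p 1 a + weight p (pred p) a       ≡⟨ weight-1+weight-pred≡dstar*p p a a<p ⟩
  dstar a * p                              ∎)
  where
    open ≤-Reasoning
    h : ℕ
    h = height p a
    1≤pred[p] : 1 ≤ pred p
    1≤pred[p] = pred-mono-≤ (nonTrivial⇒n>1 p {{prime⇒nonTrivial p-prime}})
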